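{- Let $A$ be a finite alphabet and $\theta$ a commutation relation on $A$. The trace monoid $\mathbb{M}(A,\theta)$ admits a transitive Lazard factorization (equivalently, there exists a transitive Lazard set $L\subseteq\mathcal{A}(2,A)$ for $(A,\theta)$) if and only if the commutation graph $(A,\theta)$ is a type-H graph.
   Context: $\theta\subseteq A\times A\setminus\{(a,a)\}$ is symmetric; $\mathbb{M}(A,\theta)$ is the trace monoid (quotient of $A^*$ by $ab=ba$ for $(a,b)\in\theta$). $\mathcal{A}(2,A)$ is the free magma on $A$ (binary trees with leaves in $A$, product $(t_1,t_2)$), $\mathcal{A}(2,A)^{\le n}$ the trees with at most $n$ leaves; $f:\mathcal{A}(2,A)\to\mathbb{M}(A,\theta)$ is the magma morphism that is the identity on $A$. $\theta_{\mathbb{M}}=\{(w,w')\mid ww'=w'w,\ \mathrm{Alph}(w)\cap\mathrm{Alph}(w')=\emptyset\}$. Graphs considered have finite vertex sets $V\subseteq\mathcal{A}(2,A)$, with $\{t_1,t_2\}$ an edge iff $(f(t_1),f(t_2))\in\theta_{\mathbb{M}}$; in particular $(A,\theta)$ is the graph with vertex set $A$ and edge set $\theta$. An elimination string of $(V,E)$ is a tuple $(a_1,\dots,a_k)$ of distinct vertices such that for each $i$ and all $v_1,v_2\in V\setminus\{a_1,\dots,a_i\}$, $\{v_1,v_2\}\in E$ implies $\{v_1,a_i\}\in E$ or $\{v_2,a_i\}\in E$; $a_1$ is its starting point; it is complete if $\{a_1,\dots,a_k\}=V$. A graph is type-H if it admits a complete elimination string. Writing $(t\,v^m)$ for the left comb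 $(\dots((t,v),v)\dots,v)$ with $m$ copies of $v$, the H-star $G_n^{*v}$ of $G=(V,E)$ has vertex set $((V\cap\mathcal{A}(2,A)^{\le n})\setminus\{v\})\cup\{(v'\,v^m)\in\mathcal{A}(2,A)^{\le n}\mid m>0,\ v'\in V\setminus\{v\},\ \{v',v\}\notin E\}$ and edges the pairs whose foliages are in $\theta_{\mathbb{M}}$. A set $L\subseteq\mathcal{A}(2,A)$ is a transitive Lazard set for $(A,\theta)$ if for each $n>0$ one can enumerate $L\cap\mathcal{A}(2,A)^{\le n}=\{s_1,\dots,s_k\}$ so that there exist graphs $G_1,\dots,G_{k+1}$ with: $G_1=(A,\theta)$; $G_{k+1}$ empty; each $s_i$ is a vertex of $G_i$ and the starting point of a complete elimination string of $G_i$; and $G_{i+1}=(G_i)_n^{*s_i}$. A transitive Lazard factorization of $\mathbb{M}(A,\theta)$ is the complete factorization given by the foliage $f(L)$ of a transitive Lazard set $L$. -}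

module Defs where

open import Data.Nat using (ℕ; zero; suc; _+_; _≤_; _<_)
open import Data.Fin using (Fin)
open import Data.Bool using (Bool; true)
open import Data.List using (List; []; _∷_; _++_)
open import Data.List.Membership.Propositional using (_∈_; _∉_)
open import Data.List.Relation.Unary.Unique.Propositional using (Unique)
open import Data.Product using (Σ; ∃; _×_; _,_)
open import Data.Sum using (_⊎_)
open import Data.Unit using (⊤)
open import Data.Empty using (⊥)
open import Relation.Nullary using (¬_)
open import Relation.Binary.PropositionalEquality using (_≡_; _≢_)
open import Function.Bundles using (_⇔_)

record CommRel (k : ℕ) : Set where
  field
    θ     : Fin k → Fin k → Bool
    sym   : ∀ a b → θ a b ≡ true → θ b a ≡ true
    irrefl : ∀ a → ¬ (θ a a ≡ true)
open CommRel public

module _ {k : ℕ} (C : CommRel k) where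

  Word : Set
  Word = List (Fin k)

  data _∼_ : Word → Word → Set where
    ∼-refl  : ∀ {u} → u ∼ u
    ∼-sym   : ∀ {u v} → u ∼ v → v ∼ u
    ∼-trans : ∀ {u v w} → u ∼ v → v ∼ w → u ∼ w
    ∼-swap  : ∀ u v a b → θ C a b ≡ true → (u ++ a ∷ b ∷ v) ∼ (u ++ b ∷ a ∷ v)

  -- θ_M on traces (represented by words): ww' = w'w in M(A,θ) and disjoint alphabets
  θM : Word → Word → Set
  θM w w' = ((w ++ w') ∼ (w' ++ w)) × (∀ a → a ∈ w → a ∈ w' → ⊥)

-- The free magma A(2,A): binary trees with leaves in A
data Tree (k : ℕ) : Set where
  leaf : Fin k → Tree k
  node : Tree k → Tree k → Tree k

module _ {k : ℕ} where

  size : Tree k → ℕ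
  size (leaf _)   = 1
  size (node s t) = size s + size t

  -- foliage (the magma morphism f, followed by the quotient A* → M(A,θ))
  foliage : Tree k → List (Fin k)
  foliage (leaf a)   = a ∷ []
  foliage (node s t) = foliage s ++ foliage t

  comb : Tree k → Tree k → ℕ → Tree k
  comb t v zero    = t
  comb t v (suc m) = node (comb t v m) v

-- A graph is given by its vertex set V ⊆ A(2,A); edges are determined by θ_M.
VSet : ℕ → Set₁
VSet k = Tree k → Set

module _ {k : ℕ} (C : CommRel k) where

  Edge : Tree k → Tree k → Set
  Edge t₁ t₂ = θM C (foliage t₁) (foliage t₂)

  -- condition for (a_1,...,a_k) given the already eliminated vertices
  ElimCond : VSet k → List (Tree k) → List (Tree k) → Set
  ElimCond V removed []       = ⊤
  ElimCond V removed (a ∷ as) =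
    (∀ v₁ v₂ → V v₁ → V v₂ → v₁ ∉ (a ∷ removed) → v₂ ∉ (a ∷ removed) →
       Edge v₁ v₂ → Edge v₁ a ⊎ Edge v₂ a)
    × ElimCond V (a ∷ removed) as

  ElimString : VSet k → List (Tree k) → Set
  ElimString V as = Unique as × (∀ t → t ∈ as → V t) × ElimCond V [] as

  CompleteElimString : VSet k → List (Tree k) → Set
  CompleteElimString V as = ElimString V as × (∀ t → V t → t ∈ as)

  alphabetGraph : VSet k
  alphabetGraph t = Σ (Fin k) λ a → t ≡ leaf a

  TypeH : VSet k → Set
  TypeH V = ∃ λ as → CompleteElimString V as

  HStar : ℕ → VSet k → Tree k → VSet k
  HStar n V v t =
    (V t × size t ≤ n × t ≢ v)
    ⊎ (Σ (Tree k) λ v' → Σ ℕ λ m →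
         0 < m × V v' × v' ≢ v × ¬ Edge v' v × t ≡ comb v' v m × size t ≤ n)

  LazardChain : ℕ → VSet k → List (Tree k) → Set
  LazardChain n G []       = ∀ t → ¬ G t
  LazardChain n G (s ∷ ss) =
    G s × (∃ λ rest → CompleteElimString G (s ∷ rest)) × LazardChain n (HStar n G s) ss

  TransitiveLazardSet : (Tree k → Set) → Set
  TransitiveLazardSet L =
    ∀ n → 0 < n →
      ∃ λ (ss : List (Tree k)) →
        Unique ss
        × (∀ t → (t ∈ ss) ⇔ (L t × size t ≤ n))
        × LazardChain n alphabetGraph ss

{-# OPTIONS --safe #-}
-- Two trees are θ_M-adjacent exactly when every letter of one foliage commutes with every
-- letter of the other: if a ∈ x and b ∈ y do not commute, erasing all other letters is
-- invariant under trace equivalence, yet sends xy and yx to words beginning with a and b.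
--
-- (⇒) The chain for n = 1 starts from (A, θ) with a complete elimination string (or (A, θ)
-- is empty).
-- (⇐) List a graph as an elimination order. Eliminating its head s and preceding every
-- remaining v by its combs (v s^m) of size ≤ n (none if v and s commute) lists the H-star,
-- again as an elimination order: a comb is adjacent to w iff v and s both are, and when v is
-- not adjacent to s every later neighbour of v is, by the elimination property of s, also a
-- neighbour of s. Each step eliminates a new tree of size ≤ n, so iterating terminates and
-- gives a Lazard chain. Truncating the run at level n to trees of size ≤ m yields the run at
-- level m, hence the trees eliminated at level (their own size) form a transitive Lazard set.
module Submission where

open import Defs hiding (sym)
open import Data.Nat using (ℕ; zero; suc; _+_; _≤_; _<_; z≤n; s≤s; _≤?_)
open import Data.Nat.Properties
open import Data.Fin using (Fin) renaming (_≟_ to _≟ᶠ_)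
open import Data.Bool using (true) renaming (_≟_ to _≟ᵇ_)
open import Data.List
  using (List; []; _∷_; _++_; [_]; length; map; filter; concatMap; allFin; cartesianProductWith; applyDownFrom)
open import Data.List.Properties
  using ( ++-assoc; ++-identityʳ; ∷-injectiveˡ
        ; filter-++; filter-accept; filter-reject; filter-all; filter-none; filter-notAll)
open import Data.List.Membership.Propositional using (_∈_; _∉_; find; lose)
open import Data.List.Membership.Propositional.Properties
import Data.List.Membership.DecPropositional as DecMembership
open import Data.List.Relation.Unary.Any using (here; there)
open import Data.List.Relation.Unary.Unique.Propositional using (Unique)
open import Data.List.Relation.Unary.AllPairs using ([]; _∷_)
import Data.List.Relation.Unary.AllPairs as AllPairs
import Data.List.Relation.Unary.Unique.Propositional.Properties as Unique
open import Data.List.Relation.Binary.Disjoint.Propositional using (Disjoint)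
import Data.List.Relation.Unary.All as All
open All using ([])
open import Data.Product using (∃; _×_; _,_; proj₁; proj₂; map₁; map₂; uncurry)
import Data.Product as Product
open import Data.Sum using (_⊎_; inj₁; inj₂; [_,_]′)
import Data.Sum as Sum
open import Data.Empty using (⊥; ⊥-elim)
open import Data.Unit using (⊤; tt)
open import Relation.Nullary using (¬_; Dec; yes; no)
open import Relation.Nullary.Decidable using (map′; _×-dec_; _⊎-dec_)
open import Relation.Binary.Definitions using (DecidableEquality)
open import Relation.Unary using (Pred; Decidable)
open import Relation.Binary.PropositionalEquality hiding ([_])
open import Function.Base using (id; _∘_; case_of_)
open import Function.Bundles using (_⇔_; mk⇔)
open import Induction.WellFounded using (Acc; acc)
open import Data.Nat.Induction using (<-wellFounded)

module _ {a p q} {A : Set a} {P : Pred A p} {Q : Pred A q} (P? : Decidable P) (Q? : Decidable Q) where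

  filter-filter-⇒ : (∀ {x} → P x → Q x) → ∀ xs → filter P? (filter Q? xs) ≡ filter P? xs
  filter-filter-⇒ P⇒Q [] = refl
  filter-filter-⇒ P⇒Q (x ∷ xs) with Q? x
  ... | yes _ with P? x
  ...   | yes _ = cong (x ∷_) (filter-filter-⇒ P⇒Q xs)
  ...   | no _ = filter-filter-⇒ P⇒Q xs
  filter-filter-⇒ P⇒Q (x ∷ xs) | no ¬q with P? x
  ...   | yes p = ⊥-elim (¬q (P⇒Q p))
  ...   | no _ = filter-filter-⇒ P⇒Q xs

-- Trees

module _ {k : ℕ} where

  leaf-injective : ∀ {a b : Fin k} → leaf a ≡ leaf b → a ≡ b
  leaf-injective refl = refl

  node-injective : ∀ {t u t′ u′ : Tree k} → node t u ≡ node t′ u′ → t ≡ t′ × u ≡ u′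
  node-injective refl = refl , refl

  _≟ᵗ_ : DecidableEquality (Tree k)
  leaf a ≟ᵗ leaf b = map′ (cong leaf) leaf-injective (a ≟ᶠ b)
  leaf _ ≟ᵗ node _ _ = no λ ()
  node _ _ ≟ᵗ leaf _ = no λ ()
  node t u ≟ᵗ node t′ u′ = map′ (uncurry (cong₂ node)) node-injective (t ≟ᵗ t′ ×-dec u ≟ᵗ u′)

  size-positive : ∀ (t : Tree k) → 0 < size t
  size-positive (leaf _) = s≤s z≤n
  size-positive (node t u) = ≤-trans (size-positive t) (m≤m+n (size t) (size u))

  exponent<size-comb : ∀ (v s : Tree k) m → m < size (comb v s m)
  exponent<size-comb v s zero = size-positive v
  exponent<size-comb v s (suc m) = ≤-trans (s≤s (exponent<size-comb v s m)) (m<m+n _ (size-positive s))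

  properComb : Tree k → Tree k → ℕ → Tree k
  properComb v s j = comb v s (suc j)

  size-properComb-≥ : ∀ (v s : Tree k) m → size v + size s ≤ size (properComb v s m)
  size-properComb-≥ v s zero = ≤-refl
  size-properComb-≥ v s (suc m) = ≤-trans (size-properComb-≥ v s m) (m≤m+n _ (size s))

  comb-injective : ∀ {s v u : Tree k} → (∀ x → v ≢ node x s) → (∀ x → u ≢ node x s) →
                   ∀ {i j} → comb v s i ≡ comb u s j → v ≡ u × i ≡ j
  comb-injective _  _  {zero}  {zero}  v≡u = v≡u , refl
  comb-injective _  nu {suc i} {zero}  e   = ⊥-elim (nu _ (sym e))
  comb-injective nv _  {zero}  {suc j} e   = ⊥-elim (nv _ e)
  comb-injective nv nu {suc i} {suc j} e   =
    map₂ (cong suc) (comb-injective nv nu (proj₁ (node-injective e)))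

  size≤? : ∀ n (t : Tree k) → Dec (size t ≤ n)
  size≤? n t = size t ≤? n

  truncate : ℕ → List (Tree k) → List (Tree k)
  truncate n = filter (size≤? n)

  truncate-accept : ∀ {m} t ℓ → size t ≤ m → truncate m (t ∷ ℓ) ≡ t ∷ truncate m ℓ
  truncate-accept {m} t ℓ = filter-accept (size≤? m) {x = t} {xs = ℓ}

  truncate-reject : ∀ {m} t ℓ → ¬ size t ≤ m → truncate m (t ∷ ℓ) ≡ truncate m ℓ
  truncate-reject {m} t ℓ = filter-reject (size≤? m) {x = t} {xs = ℓ}

  trees : ℕ → List (Tree k)
  trees zero = []
  trees (suc n) = map leaf (allFin k) ++ cartesianProductWith node (trees n) (trees n)

  ∈-trees : ∀ {n} t → size t ≤ n → t ∈ trees n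
  ∈-trees {zero} t t≤0 = ⊥-elim (<⇒≱ (size-positive t) t≤0)
  ∈-trees {suc n} (leaf a) _ = ∈-++⁺ˡ (∈-map⁺ leaf (∈-allFin a))
  ∈-trees {suc n} (node t u) t+u≤n = ∈-++⁺ʳ (map leaf (allFin k))
    (∈-cartesianProductWith⁺ node
      (∈-trees t (≤-pred (<-≤-trans (m<m+n (size t) (size-positive u)) t+u≤n)))
      (∈-trees u (≤-pred (<-≤-trans (m<n+m (size u) (size-positive t)) t+u≤n))))

-- Independence of traces

module _ {k : ℕ} (C : CommRel k) where

  private
    _≈_ : Word C → Word C → Set
    _≈_ = _∼_ C

  ∼-++ˡ : ∀ z {u v} → u ≈ v → (z ++ u) ≈ (z ++ v)
  ∼-++ˡ z ∼-refl = ∼-refl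
  ∼-++ˡ z (∼-sym p) = ∼-sym (∼-++ˡ z p)
  ∼-++ˡ z (∼-trans p q) = ∼-trans (∼-++ˡ z p) (∼-++ˡ z q)
  ∼-++ˡ z (∼-swap u v a b θab) =
    subst₂ _≈_ (++-assoc z u (a ∷ b ∷ v)) (++-assoc z u (b ∷ a ∷ v))
      (∼-swap (z ++ u) v a b θab)

  ∼-++ʳ : ∀ z {u v} → u ≈ v → (u ++ z) ≈ (v ++ z)
  ∼-++ʳ z ∼-refl = ∼-refl
  ∼-++ʳ z (∼-sym p) = ∼-sym (∼-++ʳ z p)
  ∼-++ʳ z (∼-trans p q) = ∼-trans (∼-++ʳ z p) (∼-++ʳ z q)
  ∼-++ʳ z (∼-swap u v a b θab) =
    subst₂ _≈_ (sym (++-assoc u (a ∷ b ∷ v) z)) (sym (++-assoc u (b ∷ a ∷ v) z))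
      (∼-swap u (v ++ z) a b θab)

  Independent : Word C → Word C → Set
  Independent x y = ∀ {a b} → a ∈ x → b ∈ y → θ C a b ≡ true

  letter-commutes : ∀ a y → (∀ {b} → b ∈ y → θ C a b ≡ true) → (a ∷ y) ≈ (y ++ [ a ])
  letter-commutes a [] _ = ∼-refl
  letter-commutes a (b ∷ y) θa =
    ∼-trans (∼-swap [] y a b (θa (here refl)))
            (∼-++ˡ [ b ] (letter-commutes a y (θa ∘ there)))

  independent⇒commute : ∀ x y → Independent x y → (x ++ y) ≈ (y ++ x)
  independent⇒commute [] y _ = subst (y ≈_) (sym (++-identityʳ y)) ∼-refl
  independent⇒commute (a ∷ x) y ind =
    ∼-trans (∼-++ˡ [ a ] (independent⇒commute x y (ind ∘ there)))
            (subst ((a ∷ y ++ x) ≈_) (++-assoc y [ a ] x)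
                   (∼-++ʳ x (letter-commutes a y (ind (here refl)))))

  module Projection (a b : Fin k) where

    InAB : Fin k → Set
    InAB c = c ≡ a ⊎ c ≡ b

    inAB? : ∀ c → Dec (InAB c)
    inAB? c = c ≟ᶠ a ⊎-dec c ≟ᶠ b

    project : Word C → Word C
    project = filter inAB?

    project-++ : ∀ u w v → project (u ++ w ++ v) ≡ project u ++ project w ++ project v
    project-++ u w v = trans (filter-++ inAB? u (w ++ v)) (cong (project u ++_) (filter-++ inAB? w v))

    project-dropped-swap : ∀ {c} → ¬ InAB c → ∀ d → project (c ∷ d ∷ []) ≡ project (d ∷ c ∷ [])
    project-dropped-swap {c} ¬c d = begin
      project (c ∷ d ∷ [])          ≡⟨ filter-reject inAB? ¬c ⟩
      project [ d ]                 ≡⟨ ++-identityʳ _ ⟨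
      project [ d ] ++ []           ≡⟨ cong (project [ d ] ++_) (filter-reject inAB? ¬c) ⟨
      project [ d ] ++ project [ c ] ≡⟨ filter-++ inAB? [ d ] [ c ] ⟨
      project (d ∷ c ∷ [])          ∎
      where open ≡-Reasoning

    module _ (¬θab : θ C a b ≢ true) where

      ¬commuting-in-AB : ∀ {c d} → θ C c d ≡ true → InAB c → InAB d → ⊥
      ¬commuting-in-AB θcd (inj₁ refl) (inj₁ refl) = CommRel.irrefl C a θcd
      ¬commuting-in-AB θcd (inj₁ refl) (inj₂ refl) = ¬θab θcd
      ¬commuting-in-AB θcd (inj₂ refl) (inj₁ refl) = ¬θab (CommRel.sym C b a θcd)
      ¬commuting-in-AB θcd (inj₂ refl) (inj₂ refl) = CommRel.irrefl C b θcd

      project-swap : ∀ {c d} → θ C c d ≡ true → project (c ∷ d ∷ []) ≡ project (d ∷ c ∷ [])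
      project-swap {c} {d} θcd with inAB? c | inAB? d
      ... | yes p | yes q = ⊥-elim (¬commuting-in-AB θcd p q)
      ... | no ¬p | _ = project-dropped-swap ¬p d
      ... | _ | no ¬q = sym (project-dropped-swap ¬q c)

      project-∼ : ∀ {u v} → u ≈ v → project u ≡ project v
      project-∼ ∼-refl = refl
      project-∼ (∼-sym p) = sym (project-∼ p)
      project-∼ (∼-trans p q) = trans (project-∼ p) (project-∼ q)
      project-∼ (∼-swap u v c d θcd) = begin
        project (u ++ c ∷ d ∷ v)
          ≡⟨ project-++ u (c ∷ d ∷ []) v ⟩
        project u ++ project (c ∷ d ∷ []) ++ project v
          ≡⟨ cong (λ w → project u ++ w ++ project v) (project-swap θcd) ⟩
        project u ++ project (d ∷ c ∷ []) ++ project v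
          ≡⟨ project-++ u (d ∷ c ∷ []) v ⟨
        project (u ++ d ∷ c ∷ v)
          ∎
        where open ≡-Reasoning

    project-head : ∀ {c x} → c ∈ x → InAB c → (∀ {d} → d ∈ x → InAB d → d ≡ c) →
                   ∃ λ r → project x ≡ c ∷ r
    project-head {c} {x} c∈x c∈AB onlyC with project x in eq
    ... | [] = ⊥-elim (case subst (c ∈_) eq (∈-filter⁺ inAB? c∈x c∈AB) of λ ())
    ... | d ∷ r with ∈-filter⁻ inAB? {xs = x} (subst (d ∈_) (sym eq) (here refl))
    ...   | d∈x , d∈AB = r , cong (_∷ r) (onlyC d∈x d∈AB)

  θM⇒independent : ∀ {x y} → θM C x y → Independent x y
  θM⇒independent {x} {y} (xy∼yx , disjoint) {a} {b} a∈x b∈y with θ C a b ≟ᵇ true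
  ... | yes θab = θab
  ... | no ¬θab = ⊥-elim (disjoint a a∈x (subst (_∈ y) (sym a≡b) b∈y))
    where
      open Projection a b

      onlyA : ∀ {c} → c ∈ x → InAB c → c ≡ a
      onlyA _ (inj₁ c≡a) = c≡a
      onlyA c∈x (inj₂ refl) = ⊥-elim (disjoint b c∈x b∈y)

      onlyB : ∀ {c} → c ∈ y → InAB c → c ≡ b
      onlyB c∈y (inj₁ refl) = ⊥-elim (disjoint a a∈x c∈y)
      onlyB _ (inj₂ c≡b) = c≡b

      a≡b : a ≡ b
      a≡b with project-head a∈x (inj₁ refl) onlyA | project-head b∈y (inj₂ refl) onlyB
      ... | r , πx | r′ , πy = ∷-injectiveˡ (begin
        a ∷ r ++ project y          ≡⟨ cong (_++ project y) πx ⟨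
        project x ++ project y      ≡⟨ filter-++ inAB? x y ⟨
        project (x ++ y)            ≡⟨ project-∼ ¬θab xy∼yx ⟩
        project (y ++ x)            ≡⟨ filter-++ inAB? y x ⟩
        project y ++ project x      ≡⟨ cong (_++ project x) πy ⟩
        b ∷ r′ ++ project x         ∎)
        where open ≡-Reasoning

  independent⇒θM : ∀ {x y} → Independent x y → θM C x y
  independent⇒θM {x} {y} ind =
    independent⇒commute x y ind , λ a a∈x a∈y → CommRel.irrefl C a (ind a∈x a∈y)

  independent? : ∀ x y → Dec (Independent x y)
  independent? x y =
    map′ (λ h a∈x b∈y → All.lookup (All.lookup h a∈x) b∈y)
         (λ ind → All.tabulate λ a∈x → All.tabulate λ b∈y → ind a∈x b∈y)
         (All.all? (λ a → All.all? (λ b → θ C a b ≟ᵇ true) y) x)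

  record _∥_ (t w : Tree k) : Set where
    constructor mk∥
    field independent : Independent (foliage t) (foliage w)
  open _∥_

  Edge⇒∥ : ∀ {t w} → Edge C t w → t ∥ w
  Edge⇒∥ = mk∥ ∘ θM⇒independent

  ∥⇒Edge : ∀ {t w} → t ∥ w → Edge C t w
  ∥⇒Edge = independent⇒θM ∘ independent

  _∥?_ : ∀ t w → Dec (t ∥ w)
  t ∥? w = map′ mk∥ independent (independent? (foliage t) (foliage w))

  ∥-sym : ∀ {t w} → t ∥ w → w ∥ t
  ∥-sym (mk∥ ind) = mk∥ λ b∈w a∈t → CommRel.sym C _ _ (ind a∈t b∈w)

  ∥-irrefl : ∀ {t} → ¬ t ∥ t
  ∥-irrefl {leaf a} (mk∥ ind) = CommRel.irrefl C a (ind (here refl) (here refl))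
  ∥-irrefl {node t u} (mk∥ ind) = ∥-irrefl {t} (mk∥ λ a∈ b∈ → ind (∈-++⁺ˡ a∈) (∈-++⁺ˡ b∈))

  node-∥⁻ : ∀ {t u w} → node t u ∥ w → t ∥ w × u ∥ w
  node-∥⁻ {t} (mk∥ ind) = mk∥ (ind ∘ ∈-++⁺ˡ) , mk∥ (ind ∘ ∈-++⁺ʳ (foliage t))

  node-∥⁺ : ∀ {t u w} → t ∥ w → u ∥ w → node t u ∥ w
  node-∥⁺ {t} (mk∥ indt) (mk∥ indu) = mk∥ λ a∈tu → [ indt , indu ]′ (∈-++⁻ (foliage t) a∈tu)

  comb-∥⁻ : ∀ {v s w} m → comb v s m ∥ w → v ∥ w
  comb-∥⁻ zero = id
  comb-∥⁻ (suc m) = comb-∥⁻ m ∘ proj₁ ∘ node-∥⁻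

  comb-∥⁺ : ∀ {v s w} m → v ∥ w → s ∥ w → comb v s m ∥ w
  comb-∥⁺ zero v∥w _ = v∥w
  comb-∥⁺ (suc m) v∥w s∥w = node-∥⁺ (comb-∥⁺ m v∥w s∥w) s∥w

  -- Elimination orders

  DominatesEdges : Tree k → List (Tree k) → Set
  DominatesEdges a ℓ = ∀ {v₁ v₂} → v₁ ∈ ℓ → v₂ ∈ ℓ → v₁ ∥ v₂ → v₁ ∥ a ⊎ v₂ ∥ a

  EliminationOrder : List (Tree k) → Set
  EliminationOrder [] = ⊤
  EliminationOrder (a ∷ ℓ) = DominatesEdges a ℓ × EliminationOrder ℓ

  dominatesEdges-⊆ : ∀ {a ℓ ℓ′} → (∀ {w} → w ∈ ℓ′ → w ∈ ℓ) →
                     DominatesEdges a ℓ → DominatesEdges a ℓ′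
  dominatesEdges-⊆ ℓ′⊆ℓ dom w₁∈ w₂∈ = dom (ℓ′⊆ℓ w₁∈) (ℓ′⊆ℓ w₂∈)

  dominatesEdges-transfer : ∀ {a b ℓ} → (∀ {w} → w ∈ ℓ → w ∥ a → w ∥ b) →
                            DominatesEdges a ℓ → DominatesEdges b ℓ
  dominatesEdges-transfer nbr dom w₁∈ w₂∈ w₁∥w₂ =
    Sum.map (nbr w₁∈) (nbr w₂∈) (dom w₁∈ w₂∈ w₁∥w₂)

  dominatesEdges-++ : ∀ {a cs ℓ} → (∀ {c w} → c ∈ cs → c ∥ w → a ∥ w) →
                      DominatesEdges a ℓ → DominatesEdges a (cs ++ ℓ)
  dominatesEdges-++ {cs = cs} below dom w₁∈ w₂∈ w₁∥w₂
    with ∈-++⁻ cs w₁∈ | ∈-++⁻ cs w₂∈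
  ... | inj₁ w₁∈cs | _ = inj₂ (∥-sym (below w₁∈cs w₁∥w₂))
  ... | inj₂ _ | inj₁ w₂∈cs = inj₁ (∥-sym (below w₂∈cs (∥-sym w₁∥w₂)))
  ... | inj₂ w₁∈ℓ | inj₂ w₂∈ℓ = dom w₁∈ℓ w₂∈ℓ w₁∥w₂

  eliminationOrder-++ : ∀ cs {ℓ} → (∀ {c} → c ∈ cs → DominatesEdges c (cs ++ ℓ)) →
                        EliminationOrder ℓ → EliminationOrder (cs ++ ℓ)
  eliminationOrder-++ [] _ eo = eo
  eliminationOrder-++ (c ∷ cs) dom eo =
    dominatesEdges-⊆ there (dom (here refl)) ,
    eliminationOrder-++ cs (dominatesEdges-⊆ there ∘ dom ∘ there) eo

  eliminationOrder⇒elimCond : ∀ {G} r ℓ → (∀ {t} → G t → t ∈ r ⊎ t ∈ ℓ) →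
                              EliminationOrder ℓ → ElimCond C G r ℓ
  eliminationOrder⇒elimCond r [] _ _ = tt
  eliminationOrder⇒elimCond {G} r (a ∷ ℓ) covered (dom , eo) =
    (λ v₁ v₂ g₁ g₂ v₁∉ v₂∉ e →
       Sum.map ∥⇒Edge ∥⇒Edge (dom (remaining g₁ v₁∉) (remaining g₂ v₂∉) (Edge⇒∥ e))) ,
    eliminationOrder⇒elimCond (a ∷ r) ℓ covered′ eo
    where
      remaining : ∀ {t} → G t → t ∉ a ∷ r → t ∈ ℓ
      remaining g t∉ with covered g
      ... | inj₁ t∈r = ⊥-elim (t∉ (there t∈r))
      ... | inj₂ (here t≡a) = ⊥-elim (t∉ (here t≡a))
      ... | inj₂ (there t∈ℓ) = t∈ℓ

      covered′ : ∀ {t} → G t → t ∈ a ∷ r ⊎ t ∈ ℓ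
      covered′ g with covered g
      ... | inj₁ t∈r = inj₁ (there t∈r)
      ... | inj₂ (here t≡a) = inj₁ (here t≡a)
      ... | inj₂ (there t∈ℓ) = inj₂ t∈ℓ

  elimCond⇒eliminationOrder : ∀ {G} r ℓ → Unique ℓ → (∀ {t} → t ∈ ℓ → G t) →
                              (∀ {t} → t ∈ ℓ → t ∉ r) → ElimCond C G r ℓ → EliminationOrder ℓ
  elimCond⇒eliminationOrder r [] _ _ _ _ = tt
  elimCond⇒eliminationOrder r (a ∷ ℓ) (a∉ℓ ∷ uniq) inG fresh (cond , ec) =
    (λ w₁∈ w₂∈ w₁∥w₂ →
       Sum.map Edge⇒∥ Edge⇒∥
         (cond _ _ (inG (there w₁∈)) (inG (there w₂∈))
               (fresh′ w₁∈) (fresh′ w₂∈) (∥⇒Edge w₁∥w₂))) ,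
    elimCond⇒eliminationOrder (a ∷ r) ℓ uniq (inG ∘ there) fresh′ ec
    where
      fresh′ : ∀ {t} → t ∈ ℓ → t ∉ a ∷ r
      fresh′ t∈ℓ (here t≡a) = All.lookup a∉ℓ t∈ℓ (sym t≡a)
      fresh′ t∈ℓ (there t∈r) = fresh (there t∈ℓ) t∈r

  -- H-stars

  combs : ℕ → Tree k → Tree k → List (Tree k)
  combs n v s = truncate n (applyDownFrom (properComb v s) n)

  newCombs : ℕ → Tree k → Tree k → List (Tree k)
  newCombs n s v with v ∥? s
  ... | yes _ = []
  ... | no _ = combs n v s

  spawn : ℕ → Tree k → Tree k → List (Tree k)
  spawn n s v = newCombs n s v ++ [ v ]

  -- When s ∷ ℓ lists the vertices of G, hstar n s ℓ lists those of the H-star G_n^{*s}.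
  hstar : ℕ → Tree k → List (Tree k) → List (Tree k)
  hstar n s = concatMap (spawn n s)

  data Spawns (n : ℕ) (s v : Tree k) : Tree k → Set where
    self        : Spawns n s v v
    proper-comb : ∀ {j} → ¬ v ∥ s → size (properComb v s j) ≤ n → Spawns n s v (properComb v s j)

  ∈-newCombs⁻ : ∀ {n s v t} → t ∈ newCombs n s v →
                ∃ λ j → t ≡ properComb v s j × ¬ v ∥ s × size t ≤ n
  ∈-newCombs⁻ {n} {s} {v} t∈ with v ∥? s
  ... | no ¬v∥s with ∈-filter⁻ (size≤? n) {xs = applyDownFrom (properComb v s) n} t∈
  ...   | t∈range , t≤n with ∈-applyDownFrom⁻ (properComb v s) {n = n} t∈range
  ...     | j , _ , t≡comb = j , t≡comb , ¬v∥s , t≤n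

  ∈-spawn⁻ : ∀ {n s v t} → t ∈ spawn n s v → Spawns n s v t
  ∈-spawn⁻ {n} {s} {v} t∈ with ∈-++⁻ (newCombs n s v) t∈
  ... | inj₁ t∈new with ∈-newCombs⁻ {n} {s} {v} t∈new
  ...   | _ , refl , ¬v∥s , t≤n = proper-comb ¬v∥s t≤n
  ∈-spawn⁻ t∈ | inj₂ (here refl) = self

  ∈-spawn⁺ : ∀ {n s v t} → Spawns n s v t → t ∈ spawn n s v
  ∈-spawn⁺ {n} {s} {v} self = ∈-++⁺ʳ (newCombs n s v) (here refl)
  ∈-spawn⁺ {n} {s} {v} (proper-comb {j} ¬v∥s t≤n) with v ∥? s
  ... | yes v∥s = ⊥-elim (¬v∥s v∥s)
  ... | no _ = ∈-++⁺ˡ (∈-filter⁺ (size≤? n) {xs = applyDownFrom (properComb v s) n}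
                        (∈-applyDownFrom⁺ (properComb v s) j<n) t≤n)
    where
      j<n : j < n
      j<n = <-≤-trans (<-trans (n<1+n j) (exponent<size-comb v s (suc j))) t≤n

  ∈-hstar⁻ : ∀ {n s ℓ t} → t ∈ hstar n s ℓ → ∃ λ v → v ∈ ℓ × Spawns n s v t
  ∈-hstar⁻ {n} {s} t∈ with find (∈-concatMap⁻ (spawn n s) t∈)
  ... | v , v∈ℓ , t∈spawn = v , v∈ℓ , ∈-spawn⁻ t∈spawn

  ∈-hstar⁺ : ∀ {n s ℓ v t} → v ∈ ℓ → Spawns n s v t → t ∈ hstar n s ℓ
  ∈-hstar⁺ {n} {s} v∈ℓ sp = ∈-concatMap⁺ (spawn n s) (lose v∈ℓ (∈-spawn⁺ sp))

  spawns-∥⁻ : ∀ {n s v t w} → Spawns n s v t → t ∥ w → v ∥ w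
  spawns-∥⁻ self = id
  spawns-∥⁻ (proper-comb {j} _ _) = comb-∥⁻ (suc j)

  ¬proper-combs-∥ : ∀ {s u u′} i j → ¬ properComb u s i ∥ properComb u′ s j
  ¬proper-combs-∥ i j c∥c′ =
    ∥-irrefl (proj₂ (node-∥⁻ (∥-sym (proj₂ (node-∥⁻ c∥c′)))))

  module _ {n : ℕ} {s v : Tree k} {ℓ : List (Tree k)} (domS : DominatesEdges s (v ∷ ℓ)) where

    hstar-∥⇒∥ : ¬ v ∥ s → ∀ {w} → w ∈ hstar n s ℓ → w ∥ v → w ∥ s
    hstar-∥⇒∥ ¬v∥s w∈ w∥v with ∈-hstar⁻ w∈
    ... | u , u∈ℓ , self =
      [ (λ v∥s → ⊥-elim (¬v∥s v∥s)) , id ]′ (domS (here refl) (there u∈ℓ) (∥-sym w∥v))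
    ... | u , u∈ℓ , proper-comb {j} _ _ = ⊥-elim (¬v∥s (∥-sym (proj₂ (node-∥⁻ w∥v))))

    comb-edge-dominated : DominatesEdges v ℓ → ∀ {u w} j → u ∈ ℓ → ¬ u ∥ s → w ∈ ℓ →
                          properComb u s j ∥ w → properComb u s j ∥ v ⊎ w ∥ v
    comb-edge-dominated domV j u∈ℓ ¬u∥s w∈ℓ c∥w with domV u∈ℓ w∈ℓ (comb-∥⁻ (suc j) c∥w)
    ... | inj₂ w∥v = inj₂ w∥v
    ... | inj₁ u∥v with domS (there u∈ℓ) (here refl) u∥v
    ...   | inj₁ u∥s = ⊥-elim (¬u∥s u∥s)
    ...   | inj₂ v∥s = inj₁ (comb-∥⁺ (suc j) u∥v (∥-sym v∥s))

    hstar-dominates : DominatesEdges v ℓ → DominatesEdges v (hstar n s ℓ)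
    hstar-dominates domV w₁∈ w₂∈ w₁∥w₂ with ∈-hstar⁻ w₁∈ | ∈-hstar⁻ w₂∈
    ... | _ , u₁∈ℓ , self | _ , u₂∈ℓ , self = domV u₁∈ℓ u₂∈ℓ w₁∥w₂
    ... | _ , u₁∈ℓ , proper-comb {i} ¬u₁∥s _ | _ , u₂∈ℓ , self =
      comb-edge-dominated domV i u₁∈ℓ ¬u₁∥s u₂∈ℓ w₁∥w₂
    ... | _ , u₁∈ℓ , self | _ , u₂∈ℓ , proper-comb {j} ¬u₂∥s _ =
      Sum.swap (comb-edge-dominated domV j u₂∈ℓ ¬u₂∥s u₁∈ℓ (∥-sym w₁∥w₂))
    ... | _ , _ , proper-comb {i} _ _ | _ , _ , proper-comb {j} _ _ = ⊥-elim (¬proper-combs-∥ i j w₁∥w₂)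

  eliminationOrder-hstar : ∀ n s ℓ → DominatesEdges s ℓ → EliminationOrder ℓ →
                           EliminationOrder (hstar n s ℓ)
  eliminationOrder-hstar n s [] _ _ = tt
  eliminationOrder-hstar n s (v ∷ ℓ) domS (domV , eo) =
    eliminationOrder-++ (spawn n s v) dominated
      (eliminationOrder-hstar n s ℓ (dominatesEdges-⊆ there domS) eo)
    where
      domV′ : DominatesEdges v (spawn n s v ++ hstar n s ℓ)
      domV′ = dominatesEdges-++ (λ t∈ → spawns-∥⁻ (∈-spawn⁻ t∈)) (hstar-dominates domS domV)

      ∥v⇒∥s : ¬ v ∥ s → ∀ {w} → w ∈ spawn n s v ++ hstar n s ℓ → w ∥ v → w ∥ s
      ∥v⇒∥s ¬v∥s w∈ w∥v with ∈-++⁻ (spawn n s v) w∈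
      ... | inj₁ w∈spawn = ⊥-elim (∥-irrefl (spawns-∥⁻ (∈-spawn⁻ w∈spawn) w∥v))
      ... | inj₂ w∈hstar = hstar-∥⇒∥ domS ¬v∥s w∈hstar w∥v

      dominated : ∀ {c} → c ∈ spawn n s v → DominatesEdges c (spawn n s v ++ hstar n s ℓ)
      dominated c∈ with ∈-spawn⁻ c∈
      ... | self = domV′
      ... | proper-comb {j} ¬v∥s _ = dominatesEdges-transfer
        (λ w∈ w∥v → ∥-sym (comb-∥⁺ (suc j) (∥-sym w∥v) (∥-sym (∥v⇒∥s ¬v∥s w∈ w∥v)))) domV′

  spawns-comb : ∀ {n s v t} → Spawns n s v t → ∃ λ j → t ≡ comb v s j
  spawns-comb self = 0 , refl
  spawns-comb (proper-comb {j} _ _) = suc j , refl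

  unique-spawn : ∀ {n s v} → (∀ x → v ≢ node x s) → Unique (spawn n s v)
  unique-spawn {n} {s} {v} nv = Unique.++⁺ unique-new ([] ∷ []) disjoint
    where
      unique-new : Unique (newCombs n s v)
      unique-new with v ∥? s
      ... | yes _ = []
      ... | no _ = Unique.filter⁺ (size≤? n) (Unique.applyDownFrom⁺₁ _ n
                     λ j<i _ e → <⇒≢ j<i (sym (suc-injective (proj₂ (comb-injective nv nv e)))))

      disjoint : Disjoint (newCombs n s v) [ v ]
      disjoint (t∈new , here t≡v) with ∈-newCombs⁻ {n} {s} {v} t∈new
      ... | j , refl , _ with proj₂ (comb-injective nv nv t≡v)
      ...   | ()

  unique-hstar : ∀ {n s} ℓ → Unique ℓ → (∀ {v} → v ∈ ℓ → ∀ x → v ≢ node x s) →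
                 Unique (hstar n s ℓ)
  unique-hstar [] _ _ = []
  unique-hstar {n} {s} (v ∷ ℓ) (v∉ℓ ∷ uniq) nrf =
    Unique.++⁺ (unique-spawn (nrf (here refl))) (unique-hstar ℓ uniq (nrf ∘ there)) disjoint
    where
      disjoint : Disjoint (spawn n s v) (hstar n s ℓ)
      disjoint (t∈spawn , t∈hstar) with ∈-hstar⁻ t∈hstar
      ... | u , u∈ℓ , sp with spawns-comb (∈-spawn⁻ t∈spawn) | spawns-comb sp
      ...   | _ , refl | _ , e =
        All.lookup v∉ℓ u∈ℓ (proj₁ (comb-injective (nrf (here refl)) (nrf (there u∈ℓ)) e))

  combs-range : ∀ {m} (v s : Tree k) n → m ≤ n →
                truncate m (applyDownFrom (properComb v s) n) ≡
                truncate m (applyDownFrom (properComb v s) m)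
  combs-range v s zero z≤n = refl
  combs-range v s (suc n) m≤1+n with m≤n⇒m<n∨m≡n m≤1+n
  ... | inj₂ refl = refl
  ... | inj₁ (s≤s m≤n) =
    trans (truncate-reject (properComb v s n) (applyDownFrom (properComb v s) n) (<⇒≱ comb>m))
          (combs-range v s n m≤n)
    where
      comb>m : _ < size (properComb v s n)
      comb>m = ≤-<-trans (≤-trans m≤n (n≤1+n n)) (exponent<size-comb v s (suc n))

  truncate-combs : ∀ {m n} v s → m ≤ n → truncate m (combs n v s) ≡ combs m v s
  truncate-combs {m} {n} v s m≤n =
    trans (filter-filter-⇒ (size≤? m) (size≤? n) (λ t≤m → ≤-trans t≤m m≤n) (applyDownFrom (properComb v s) n))
          (combs-range v s n m≤n)

  combs-≡[] : ∀ {m} v s → m < size v + size s → combs m v s ≡ []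
  combs-≡[] {m} v s m<v+s = filter-none (size≤? m) (All.tabulate too-big)
    where
      too-big : ∀ {t} → t ∈ applyDownFrom (properComb v s) m → ¬ size t ≤ m
      too-big t∈ with ∈-applyDownFrom⁻ (properComb v s) {n = m} t∈
      ... | j , _ , refl = <⇒≱ (<-≤-trans m<v+s (size-properComb-≥ v s j))

  truncate-newCombs : ∀ {m n} s v → m ≤ n → truncate m (newCombs n s v) ≡ newCombs m s v
  truncate-newCombs s v m≤n with v ∥? s
  ... | yes _ = refl
  ... | no _ = truncate-combs v s m≤n

  newCombs-≡[] : ∀ {m} s v → m < size v + size s → newCombs m s v ≡ []
  newCombs-≡[] s v m<v+s with v ∥? s
  ... | yes _ = refl
  ... | no _ = combs-≡[] v s m<v+s

  truncate-spawn : ∀ {m n} s v → m ≤ n → truncate m (spawn n s v) ≡ newCombs m s v ++ truncate m [ v ]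
  truncate-spawn {m} {n} s v m≤n =
    trans (filter-++ (size≤? m) (newCombs n s v) [ v ]) (cong (_++ truncate m [ v ]) (truncate-newCombs s v m≤n))

  truncate-hstar : ∀ {m n} s → m ≤ n → ∀ ℓ → truncate m (hstar n s ℓ) ≡ hstar m s (truncate m ℓ)
  truncate-hstar s m≤n [] = refl
  truncate-hstar {m} {n} s m≤n (v ∷ ℓ) = begin
    truncate m (spawn n s v ++ hstar n s ℓ)
      ≡⟨ filter-++ (size≤? m) (spawn n s v) (hstar n s ℓ) ⟩
    truncate m (spawn n s v) ++ truncate m (hstar n s ℓ)
      ≡⟨ cong₂ _++_ (truncate-spawn s v m≤n) (truncate-hstar s m≤n ℓ) ⟩
    (newCombs m s v ++ truncate m [ v ]) ++ hstar m s (truncate m ℓ)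
      ≡⟨ spawn-head (size≤? m v) ⟩
    hstar m s (truncate m (v ∷ ℓ))
      ∎
    where
      open ≡-Reasoning
      spawn-head : Dec (size v ≤ m) →
                   (newCombs m s v ++ truncate m [ v ]) ++ hstar m s (truncate m ℓ) ≡
                   hstar m s (truncate m (v ∷ ℓ))
      spawn-head (yes v≤m) = trans
        (cong (λ x → (newCombs m s v ++ x) ++ hstar m s (truncate m ℓ)) (truncate-accept v [] v≤m))
        (cong (hstar m s) (sym (truncate-accept v ℓ v≤m)))
      spawn-head (no v≰m) = trans
        (cong₂ (λ x y → (x ++ y) ++ hstar m s (truncate m ℓ))
               (newCombs-≡[] s v (<-≤-trans (≰⇒> v≰m) (m≤m+n (size v) (size s))))
               (truncate-reject v [] v≰m))
        (cong (hstar m s) (sym (truncate-reject v ℓ v≰m)))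

  truncate-hstar-large : ∀ {m n} s → m ≤ n → m < size s → ∀ ℓ →
                         truncate m (hstar n s ℓ) ≡ truncate m ℓ
  truncate-hstar-large s m≤n m<s [] = refl
  truncate-hstar-large {m} {n} s m≤n m<s (v ∷ ℓ) = begin
    truncate m (spawn n s v ++ hstar n s ℓ)
      ≡⟨ filter-++ (size≤? m) (spawn n s v) (hstar n s ℓ) ⟩
    truncate m (spawn n s v) ++ truncate m (hstar n s ℓ)
      ≡⟨ cong₂ _++_ (truncate-spawn s v m≤n) (truncate-hstar-large s m≤n m<s ℓ) ⟩
    (newCombs m s v ++ truncate m [ v ]) ++ truncate m ℓ
      ≡⟨ cong (λ x → (x ++ truncate m [ v ]) ++ truncate m ℓ)
              (newCombs-≡[] s v (<-≤-trans m<s (m≤n+m (size s) (size v)))) ⟩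
    truncate m [ v ] ++ truncate m ℓ
      ≡⟨ filter-++ (size≤? m) [ v ] ℓ ⟨
    truncate m (v ∷ ℓ)
      ∎
    where open ≡-Reasoning

  -- Lazard runs

  -- E lists the trees eliminated so far; the last two fields guarantee that no listed tree is
  -- of the form (x s) when s is eliminated, which keeps the combs of distinct vertices distinct.
  record LazardState (n : ℕ) (G : VSet k) (ℓ E : List (Tree k)) : Set where
    field
      vertex⇒∈ : ∀ {t} → G t → t ∈ ℓ
      ∈⇒vertex : ∀ {t} → t ∈ ℓ → G t
      unique : Unique ℓ
      eliminationOrder : EliminationOrder ℓ
      bounded : ∀ {t} → t ∈ ℓ → size t ≤ n
      fresh : ∀ {t} → t ∈ ℓ → t ∉ E
      rightFactor-eliminated : ∀ {x y} → node x y ∈ ℓ → y ∈ E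
      eliminated-closed : ∀ {x y} → node x y ∈ E → y ∈ E

  module Step {n G s ℓ E} (st : LazardState n G (s ∷ ℓ) E) where
    open LazardState st

    ≢s : ∀ {v} → v ∈ ℓ → v ≢ s
    ≢s v∈ℓ refl = All.lookup (AllPairs.head unique) v∈ℓ refl

    ¬rightFactor-s : ∀ {v} → v ∈ ℓ → ∀ x → v ≢ node x s
    ¬rightFactor-s v∈ℓ x refl = fresh (here refl) (rightFactor-eliminated (there v∈ℓ))

    hstar-vertex⇒∈ : ∀ {t} → HStar C n G s t → t ∈ hstar n s ℓ
    hstar-vertex⇒∈ (inj₁ (g , _ , t≢s)) with vertex⇒∈ g
    ... | here t≡s = ⊥-elim (t≢s t≡s)
    ... | there t∈ℓ = ∈-hstar⁺ t∈ℓ self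
    hstar-vertex⇒∈ (inj₂ (v , suc j , _ , g , v≢s , ¬E , refl , t≤n)) with vertex⇒∈ g
    ... | here v≡s = ⊥-elim (v≢s v≡s)
    ... | there v∈ℓ = ∈-hstar⁺ v∈ℓ (proper-comb (¬E ∘ ∥⇒Edge) t≤n)

    hstar-∈⇒vertex : ∀ {t} → t ∈ hstar n s ℓ → HStar C n G s t
    hstar-∈⇒vertex t∈ with ∈-hstar⁻ t∈
    ... | v , v∈ℓ , self = inj₁ (∈⇒vertex (there v∈ℓ) , bounded (there v∈ℓ) , ≢s v∈ℓ)
    ... | v , v∈ℓ , proper-comb {j} ¬v∥s t≤n =
      inj₂ (v , suc j , s≤s z≤n , ∈⇒vertex (there v∈ℓ) , ≢s v∈ℓ , ¬v∥s ∘ Edge⇒∥ , refl , t≤n)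

    hstar-bounded : ∀ {t} → t ∈ hstar n s ℓ → size t ≤ n
    hstar-bounded t∈ with ∈-hstar⁻ t∈
    ... | _ , v∈ℓ , self = bounded (there v∈ℓ)
    ... | _ , _ , proper-comb _ t≤n = t≤n

    hstar-fresh : ∀ {t} → t ∈ hstar n s ℓ → t ∉ s ∷ E
    hstar-fresh t∈ t∈sE with ∈-hstar⁻ t∈ | t∈sE
    ... | _ , v∈ℓ , self | here v≡s = ≢s v∈ℓ v≡s
    ... | _ , v∈ℓ , self | there v∈E = fresh (there v∈ℓ) v∈E
    ... | v , _ , proper-comb {j} _ _ | here c≡s =
      <⇒≢ (<-≤-trans (m<n+m (size s) (size-positive v)) (size-properComb-≥ v s j)) (cong size (sym c≡s))
    ... | _ , _ , proper-comb _ _ | there c∈E = fresh (here refl) (eliminated-closed c∈E)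

    hstar-rightFactor-eliminated : ∀ {x y} → node x y ∈ hstar n s ℓ → y ∈ s ∷ E
    hstar-rightFactor-eliminated t∈ with ∈-hstar⁻ t∈
    ... | _ , v∈ℓ , self = there (rightFactor-eliminated (there v∈ℓ))
    ... | _ , _ , proper-comb _ _ = here refl

    eliminated-closed-∷ : ∀ {x y} → node x y ∈ s ∷ E → y ∈ s ∷ E
    eliminated-closed-∷ (here refl) = there (rightFactor-eliminated (here refl))
    eliminated-closed-∷ (there t∈E) = there (eliminated-closed t∈E)

    step : LazardState n (HStar C n G s) (hstar n s ℓ) (s ∷ E)
    step = record
      { vertex⇒∈ = hstar-vertex⇒∈
      ; ∈⇒vertex = hstar-∈⇒vertex
      ; unique = unique-hstar ℓ (AllPairs.tail unique) ¬rightFactor-s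
      ; eliminationOrder = eliminationOrder-hstar n s ℓ (proj₁ eliminationOrder) (proj₂ eliminationOrder)
      ; bounded = hstar-bounded
      ; fresh = hstar-fresh
      ; rightFactor-eliminated = hstar-rightFactor-eliminated
      ; eliminated-closed = eliminated-closed-∷
      }

  data LazardRun (n : ℕ) : List (Tree k) → List (Tree k) → Set where
    done      : LazardRun n [] []
    eliminate : ∀ s {ℓ ss} → LazardRun n (hstar n s ℓ) ss → LazardRun n (s ∷ ℓ) (s ∷ ss)

  lazardRun-deterministic : ∀ {n ℓ ss ss′} → LazardRun n ℓ ss → LazardRun n ℓ ss′ → ss ≡ ss′
  lazardRun-deterministic done done = refl
  lazardRun-deterministic (eliminate s r) (eliminate .s r′) = cong (s ∷_) (lazardRun-deterministic r r′)

  lazardRun-truncate : ∀ {m n ℓ ss} → m ≤ n → LazardRun n ℓ ss →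
                       LazardRun m (truncate m ℓ) (truncate m ss)
  lazardRun-truncate m≤n done = done
  lazardRun-truncate {m} m≤n (eliminate s {ℓ} {ss} r) with size≤? m s
  ... | yes s≤m =
    subst₂ (LazardRun m) (sym (truncate-accept s ℓ s≤m)) (sym (truncate-accept s ss s≤m))
      (eliminate s (subst (λ ℓ′ → LazardRun m ℓ′ (truncate m ss)) (truncate-hstar s m≤n ℓ)
                          (lazardRun-truncate m≤n r)))
  ... | no s≰m =
    subst₂ (LazardRun m) (sym (truncate-reject s ℓ s≰m)) (sym (truncate-reject s ss s≰m))
      (subst (λ ℓ′ → LazardRun m ℓ′ (truncate m ss)) (truncate-hstar-large s m≤n (≰⇒> s≰m) ℓ)
             (lazardRun-truncate m≤n r))

  completeElimString : ∀ {n G ℓ E} → LazardState n G ℓ E → CompleteElimString C G ℓ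
  completeElimString {ℓ = ℓ} st =
    (unique , (λ _ → ∈⇒vertex) ,
     eliminationOrder⇒elimCond [] ℓ (inj₂ ∘ vertex⇒∈) eliminationOrder) ,
    (λ _ → vertex⇒∈)
    where open LazardState st

  lazardRun-chain : ∀ {n G ℓ E ss} → LazardState n G ℓ E → LazardRun n ℓ ss → LazardChain C n G ss
  lazardRun-chain st done t g = case LazardState.vertex⇒∈ st g of λ ()
  lazardRun-chain st (eliminate s r) =
    LazardState.∈⇒vertex st (here refl) , (_ , completeElimString st) , lazardRun-chain (Step.step st) r

  lazardRun-fresh : ∀ {n G ℓ E ss t} → LazardState n G ℓ E → LazardRun n ℓ ss → t ∈ ss →
                    t ∉ E × size t ≤ n
  lazardRun-fresh st (eliminate s r) (here refl) =
    LazardState.fresh st (here refl) , LazardState.bounded st (here refl)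
  lazardRun-fresh st (eliminate s r) (there t∈) = map₁ (_∘ there) (lazardRun-fresh (Step.step st) r t∈)

  lazardRun-unique : ∀ {n G ℓ E ss} → LazardState n G ℓ E → LazardRun n ℓ ss → Unique ss
  lazardRun-unique st done = []
  lazardRun-unique st (eliminate s r) =
    All.tabulate (λ t∈ s≡t → proj₁ (lazardRun-fresh (Step.step st) r t∈) (here (sym s≡t))) ∷
    lazardRun-unique (Step.step st) r

  open DecMembership (_≟ᵗ_ {k}) using (_∉?_)

  unvisited : ℕ → List (Tree k) → ℕ
  unvisited n E = length (filter (_∉? E) (trees n))

  unvisited-∷ : ∀ {n s E} → size s ≤ n → s ∉ E → unvisited n (s ∷ E) < unvisited n E
  unvisited-∷ {n} {s} {E} s≤n s∉E = begin-strict
    length (filter (_∉? s ∷ E) (trees n))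
      ≡⟨ cong length (filter-filter-⇒ (_∉? s ∷ E) (_∉? E) (_∘ there) (trees n)) ⟨
    length (filter (_∉? s ∷ E) (filter (_∉? E) (trees n)))
      <⟨ filter-notAll (_∉? s ∷ E) _
           (lose (∈-filter⁺ (_∉? E) (∈-trees s s≤n) s∉E) (λ s∉sE → s∉sE (here refl))) ⟩
    length (filter (_∉? E) (trees n))
      ∎
    where open ≤-Reasoning

  lazardRun-exists : ∀ {n G ℓ E} → LazardState n G ℓ E → ∃ (LazardRun n ℓ)
  lazardRun-exists st = go st (<-wellFounded _)
    where
      go : ∀ {n G ℓ E} → LazardState n G ℓ E → Acc _<_ (unvisited n E) → ∃ (LazardRun n ℓ)
      go {ℓ = []} _ _ = [] , done
      go {ℓ = s ∷ ℓ} st (acc rs) =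
        Product.map (s ∷_) (eliminate s)
          (go (Step.step st)
              (rs (unvisited-∷ (LazardState.bounded st (here refl)) (LazardState.fresh st (here refl)))))

  lazardChain⇒typeH : ∀ {n G ss} → LazardChain C n G ss → TypeH C G
  lazardChain⇒typeH {ss = []} empty = [] , (([] , (λ _ ()) , tt) , λ t g → ⊥-elim (empty t g))
  lazardChain⇒typeH {ss = s ∷ _} (_ , (rest , ces) , _) = s ∷ rest , ces

  initialState : ∀ {as n} → CompleteElimString C (alphabetGraph C) as → 0 < n →
                 LazardState n (alphabetGraph C) as []
  initialState {as} {n} ((uniq , inG , cond) , complete) 0<n = record
    { vertex⇒∈ = complete _
    ; ∈⇒vertex = inG _
    ; unique = uniq
    ; eliminationOrder = elimCond⇒eliminationOrder [] as uniq (inG _) (λ _ ()) cond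
    ; bounded = λ t∈ → leaf-size≤ (inG _ t∈)
    ; fresh = λ _ ()
    ; rightFactor-eliminated = λ t∈ → case inG _ t∈ of λ ()
    ; eliminated-closed = λ ()
    }
    where
      leaf-size≤ : ∀ {t} → alphabetGraph C t → size t ≤ n
      leaf-size≤ (_ , refl) = 0<n

  lazardSet : List (Tree k) → Tree k → Set
  lazardSet as t = ∃ λ ss → LazardRun (size t) as ss × t ∈ ss

  module _ {as} (ces : CompleteElimString C (alphabetGraph C) as) where

    truncate-alphabet : ∀ {m} → 0 < m → truncate m as ≡ as
    truncate-alphabet 0<m = filter-all (size≤? _) (All.tabulate (LazardState.bounded (initialState ces 0<m)))

    lazardRun-restrict : ∀ {m n ss} → 0 < m → m ≤ n → LazardRun n as ss → LazardRun m as (truncate m ss)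
    lazardRun-restrict 0<m m≤n r =
      subst (λ ℓ → LazardRun _ ℓ _) (truncate-alphabet 0<m) (lazardRun-truncate m≤n r)

    lazardSet-transitive : TransitiveLazardSet C (lazardSet as)
    lazardSet-transitive n 0<n with lazardRun-exists (initialState ces 0<n)
    ... | ss , run = ss , lazardRun-unique st run , (λ t → mk⇔ (to t) (from t)) , lazardRun-chain st run
      where
        st : LazardState n (alphabetGraph C) as []
        st = initialState ces 0<n

        to : ∀ t → t ∈ ss → lazardSet as t × size t ≤ n
        to t t∈ss = (truncate (size t) ss , lazardRun-restrict (size-positive t) t≤n run ,
                     ∈-filter⁺ (size≤? _) t∈ss ≤-refl) , t≤n
          where
            t≤n : size t ≤ n
            t≤n = proj₂ (lazardRun-fresh st run t∈ss)

        from : ∀ t → lazardSet as t × size t ≤ n → t ∈ ss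
        from t ((ss′ , run′ , t∈ss′) , t≤n) =
          proj₁ (∈-filter⁻ (size≤? _)
            (subst (t ∈_) (lazardRun-deterministic run′ (lazardRun-restrict (size-positive t) t≤n run))
                   t∈ss′))

theorem3 : (k : ℕ) (C : CommRel k) →
    (∃ λ L → TransitiveLazardSet C L) ⇔ TypeH C (alphabetGraph C)
theorem3 _ C = mk⇔
  (λ (_ , transitive) → lazardChain⇒typeH C (proj₂ (proj₂ (proj₂ (transitive 1 ≤-refl)))))
  (λ (as , ces) → lazardSet C as , lazardSet-transitive C ces)
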